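{- Let $m\ge 3$ be odd, let $s$ be a positive integer and $n=sm$. For $i\in\{2,\dots,n\}$ let $\ell_i = 1+\frac{(i-2)(i-1)}{2}$. Define the automorphisms of $\Gamma=C_n[mK_1]$ $$\sigma_1=(c,1,1,\dots,1)r,\qquad \sigma_2=(t,tc^{\ell_2},tc^{\ell_3},\dots,tc^{\ell_n})z,$$ and let $G=\langle\sigma_1,\sigma_2\rangle$. Then $\sigma_1$ has order $mn$, $\sigma_2$ has order $2m$, $\sigma_1\sigma_2$ has order $2$, and $|G|=2m^2n$.
   Context: $C_n[mK_1]$ has vertex set $\{1,\dots,n\}\times\{1,\dots,m\}$ with $(i_1,j_1)\sim(i_2,j_2)$ iff $i_1\equiv i_2\pm1\pmod n$ (residues mod $n$ are represented by $1,\dots,n$, and mod $m$ by $1,\dots,m$). For $\alpha_1,\dots,\alpha_n\in S_m$ (permutations of $\{1,\dots,m\}$) and a permutation $x$ of $\{1,\dots,n\}$ preserving the cycle $C_n$, $(\alpha_1,\dots,\alpha_n)x$ denotes the permutation of the vertex set $(i,j)\mapsto(ix,\,j\alpha_i)$; permutations act on the right and products are composed left to right (first the left factor). Here $c=(1\,2\,\cdots\,m)\in S_m$, $t\in S_m$ is the involution fixing $1$ and swapping $j$ with $m-j+2$ for $2\le j\le m$, $r=(1\,2\,\cdots\,n)$, and $z$ is the permutation of $\{1,\dots,n\}$ fixing $1$ and swapping $j$ with $n-j+2$ for $2\le j\le n$; $1$ denotes the identity. -}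

module Defs where

open import Level using (Level)
open import Data.Nat.Base using (ℕ; zero; suc; _+_; _*_; _∸_; _/_; _<_; NonZero)
open import Data.Nat.Properties using (m*n≢0)
open import Data.Nat.DivMod using (_mod_)
open import Data.Fin.Base using (Fin; toℕ)
open import Data.Product using (Σ; ∃; _×_; _,_)
open import Relation.Binary.PropositionalEquality using (_≡_)
open import Relation.Nullary using (¬_)

-- Conventions: residues 1..k are represented 0-based by Fin k
-- (Fin element a stands for residue a+1).

_≗_ : ∀ {a} {A : Set a} → (A → A) → (A → A) → Set a
f ≗ g = ∀ x → f x ≡ g x

idf : ∀ {a} {A : Set a} → A → A
idf x = x

_⨾_ : ∀ {a} {A : Set a} → (A → A) → (A → A) → (A → A)
(f ⨾ g) x = g (f x)

pow : ∀ {a} {A : Set a} → (A → A) → ℕ → (A → A)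
pow f zero    = idf
pow f (suc k) = pow f k ⨾ f

HasOrder : ∀ {a} {A : Set a} → (A → A) → ℕ → Set a
HasOrder f k = (0 < k) × (pow f k ≗ idf)
             × (∀ j → 0 < j → j < k → ¬ (pow f j ≗ idf))

data ⟨_,_⟩ {a} {A : Set a} (g₁ g₂ : A → A) : (A → A) → Set a where
  gen₁ : ⟨ g₁ , g₂ ⟩ g₁
  gen₂ : ⟨ g₁ , g₂ ⟩ g₂
  one  : ⟨ g₁ , g₂ ⟩ idf
  mul  : ∀ {f g} → ⟨ g₁ , g₂ ⟩ f → ⟨ g₁ , g₂ ⟩ g → ⟨ g₁ , g₂ ⟩ (f ⨾ g)
  inv  : ∀ {f g} → ⟨ g₁ , g₂ ⟩ f → (f ⨾ g) ≗ idf → (g ⨾ f) ≗ idf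
       → ⟨ g₁ , g₂ ⟩ g
  ext  : ∀ {f g} → ⟨ g₁ , g₂ ⟩ f → f ≗ g → ⟨ g₁ , g₂ ⟩ g

HasSize : ∀ {a} {A : Set a} → ((A → A) → Set a) → ℕ → Set a
HasSize {A = A} P N =
  Σ (Fin N → (A → A)) λ e →
      (∀ i → P (e i))
    × (∀ i j → e i ≗ e j → i ≡ j)
    × (∀ f → P f → ∃ λ i → f ≗ e i)

Odd : ℕ → Set
Odd m = ∃ λ k → m ≡ 2 * k + 1

-- c^ℓ : j ↦ j + ℓ (mod k)   (c = (1 2 ... k), so c = cpow 1)
cpow : ∀ {k} .{{_ : NonZero k}} → ℕ → Fin k → Fin k
cpow {k} ℓ j = (toℕ j + ℓ) mod k

-- reflection fixing 1, swapping j with k - j + 2 (0-based: a ↦ -a mod k);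
-- this is t on {1..m} and z on {1..n}
refl₁ : ∀ {k} .{{_ : NonZero k}} → Fin k → Fin k
refl₁ {k} j = (k ∸ toℕ j) mod k

-- ℓ_i = 1 + (i-2)(i-1)/2, written for the 0-based index a = i - 1
ell : ℕ → ℕ
ell a = 1 + ((a ∸ 1) * a) / 2

-- α_i ∈ S_m : α_1 = t, α_i = t c^{ℓ_i} (first t, then c^{ℓ_i}) for i ≥ 2
alpha : ∀ {m} .{{_ : NonZero m}} → ℕ → Fin m → Fin m
alpha zero    = refl₁
alpha (suc a) = refl₁ ⨾ cpow (ell (suc a))

-- The graph C_n[mK_1] with n = s m has vertex set Fin n × Fin m.

Vtx : (m s : ℕ) → Set
Vtx m s = Fin (s * m) × Fin m

-- σ₁ = (c,1,...,1) r : (i,j) ↦ (i r, j α_i)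
σ₁ : (m s : ℕ) .{{_ : NonZero m}} .{{_ : NonZero s}} → Vtx m s → Vtx m s
σ₁ m s (i , j) = cpow {{m*n≢0 s m}} 1 i , second (toℕ i) j
  where
  second : ℕ → Fin m → Fin m
  second zero    = cpow 1
  second (suc _) = idf

-- σ₂ = (t, t c^{ℓ_2}, ..., t c^{ℓ_n}) z : (i,j) ↦ (i z, j α_i)
σ₂ : (m s : ℕ) .{{_ : NonZero m}} .{{_ : NonZero s}} → Vtx m s → Vtx m s
σ₂ m s (i , j) = refl₁ {{m*n≢0 s m}} i , alpha (toℕ i) j

module Submission where

-- Put n = s m and give the vertex (i, j) of C_n[mK₁] (0-based) the spiral coordinate
-- i + n (j − [i ≠ 0]) in ℤ/nm.  In this coordinate σ₁ is x ↦ x + 1, and since the twist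
-- ℓ of layer a + 1 is 1 + a(a+1)/2, σ₂ is x ↦ −x + n·x(x−1)/2, where 1/2 is taken modulo the
-- odd number m.  The maps  x ↦ ±x + c₀ + n (c₁ x + [−]·x(x−1)/2)  with c₀ mod nm and c₁ mod m
-- are closed under composition and inversion, because the n·(…) part only depends on its
-- argument modulo m (n² ≡ 0 mod nm), and each is determined by its values at 0 and 1.  So
-- every element of G is one of these 2·nm·m maps, and conversely the words
-- σ₂^ε (σ₂²)^a σ₁^r (ε < 2, a < m, r < nm) realise each of them exactly once: |G| = 2m²n.
-- The orders of σ₁ (translation by 1), σ₂ and σ₁σ₂ are read off from the same parameters.

open import Defs
open import Data.Bool.Base using (Bool; true; false; _xor_)
open import Data.Bool.Properties using (xor-same; xor-identityʳ)
open import Data.Fin.Base using (Fin; toℕ; fromℕ<; combine; remQuot)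
open import Data.Fin.Properties as Finₚ using (2↔Bool; *↔×)
open import Data.Integer.Base as ℤ using (ℤ; +_; -_; _+_; _-_; _%ℕ_; _/ℕ_)
import Data.Integer.Properties as ℤₚ
open import Data.Integer.DivMod using (a≡a%ℕn+[a/ℕn]*n; n%ℕd<d)
open import Data.Integer.Divisibility.Signed
open import Data.Integer.Tactic.RingSolver using (solve-∀)
open import Data.Nat.Base as ℕ using (ℕ; zero; suc; NonZero; _%_; _∸_)
import Data.Nat.Properties as ℕₚ
import Data.Nat.DivMod as ℕ÷
import Data.Nat.Divisibility as ℕᵈ
import Data.Nat.Tactic.RingSolver as ℕ-Solver
open import Data.Product using (Σ; ∃; _×_; _,_; proj₁; proj₂; uncurry)
open import Data.Product.Function.NonDependent.Propositional using (_×-↔_)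
open import Data.Sum using (_⊎_; inj₁; inj₂; [_,_]′)
open import Function.Base using (_∘_)
open import Function.Bundles using (_↔_; Inverse)
open import Function.Construct.Composition using (_↔-∘_)
open import Function.Construct.Identity using (↔-id)
open import Relation.Binary.Bundles using (Setoid)
import Relation.Binary.Reasoning.Setoid as SetoidReasoning
open import Relation.Binary.PropositionalEquality
  using (_≡_; refl; sym; trans; cong; cong₂; subst; subst₂; module ≡-Reasoning)
open import Relation.Nullary using (¬_; contradiction)

module IntegerCongruence where

  open import Data.Integer.Base using (_*_)

  infix 4 _≡_mod_

  record _≡_mod_ (x y d : ℤ) : Set where
    constructor congruent
    field divides-difference : d ∣ x - y

  module _ {d : ℤ} where

    mod-reflexive : ∀ {x y} → x ≡ y → x ≡ y mod d
    mod-reflexive {x} refl = congruent (divides (+ 0) (ℤₚ.+-inverseʳ x))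

    mod-refl : ∀ {x} → x ≡ x mod d
    mod-refl = mod-reflexive refl

    mod-sym : ∀ {x y} → x ≡ y mod d → y ≡ x mod d
    mod-sym {x} {y} (congruent p) = congruent (subst (d ∣_) (negate x y) (∣m⇒∣-m p))
      where
      negate : ∀ x y → - (x - y) ≡ y - x
      negate = solve-∀

    mod-trans : ∀ {x y z} → x ≡ y mod d → y ≡ z mod d → x ≡ z mod d
    mod-trans {x} {y} {z} (congruent p) (congruent q) =
      congruent (subst (d ∣_) (telescope x y z) (∣m∣n⇒∣m+n p q))
      where
      telescope : ∀ x y z → (x - y) + (y - z) ≡ x - z
      telescope = solve-∀

    mod-setoid : Setoid _ _
    mod-setoid = record
      { Carrier = ℤ
      ; _≈_ = λ x y → x ≡ y mod d
      ; isEquivalence = record { refl = mod-refl ; sym = mod-sym ; trans = mod-trans }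
      }

    module ModReasoning = SetoidReasoning mod-setoid

    +-cong-mod : ∀ {x x′ y y′} → x ≡ x′ mod d → y ≡ y′ mod d → x + y ≡ x′ + y′ mod d
    +-cong-mod {x} {x′} {y} {y′} (congruent p) (congruent q) =
      congruent (subst (d ∣_) (regroup x x′ y y′) (∣m∣n⇒∣m+n p q))
      where
      regroup : ∀ x x′ y y′ → (x - x′) + (y - y′) ≡ (x + y) - (x′ + y′)
      regroup = solve-∀

    *-cong-mod : ∀ {x x′ y y′} → x ≡ x′ mod d → y ≡ y′ mod d → x * y ≡ x′ * y′ mod d
    *-cong-mod {x} {x′} {y} {y′} (congruent p) (congruent q) =
      congruent (subst (d ∣_) (regroup x x′ y y′) (∣m∣n⇒∣m+n (∣m⇒∣m*n y p) (∣n⇒∣m*n x′ q)))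
      where
      regroup : ∀ x x′ y y′ → (x - x′) * y + x′ * (y - y′) ≡ x * y - x′ * y′
      regroup = solve-∀

    *-congˡ-mod : ∀ c {x y} → x ≡ y mod d → c * x ≡ c * y mod d
    *-congˡ-mod c = *-cong-mod (mod-refl {c})

    *-congʳ-mod : ∀ c {x y} → x ≡ y mod d → x * c ≡ y * c mod d
    *-congʳ-mod c p = *-cong-mod p (mod-refl {c})

    +-congˡ-mod : ∀ c {x y} → x ≡ y mod d → c + x ≡ c + y mod d
    +-congˡ-mod c = +-cong-mod (mod-refl {c})

    +-congʳ-mod : ∀ c {x y} → x ≡ y mod d → x + c ≡ y + c mod d
    +-congʳ-mod c p = +-cong-mod p (mod-refl {c})

    +-cancelˡ-mod : ∀ {x x′ y y′} → x + y ≡ x′ + y′ mod d → x ≡ x′ mod d → y ≡ y′ mod d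
    +-cancelˡ-mod {x} {x′} {y} {y′} (congruent p) (congruent q) =
      congruent (subst (d ∣_) (regroup x x′ y y′) (∣m∣n⇒∣m-n p q))
      where
      regroup : ∀ x x′ y y′ → ((x + y) - (x′ + y′)) - (x - x′) ≡ y - y′
      regroup = solve-∀

    +-multiple-mod : ∀ x q → x + q * d ≡ x mod d
    +-multiple-mod x q = congruent (divides q (cancel x (q * d)))
      where
      cancel : ∀ x y → (x + y) - x ≡ y
      cancel = solve-∀

  mod-weaken : ∀ {d e x y} → d ∣ e → x ≡ y mod e → x ≡ y mod d
  mod-weaken d∣e (congruent p) = congruent (∣-trans d∣e p)

  *-scale-mod : ∀ c {d x y} → x ≡ y mod d → c * x ≡ c * y mod c * d
  *-scale-mod c {d} {x} {y} (congruent p) = congruent (subst (c * d ∣_) (distrib c x y) (*-monoʳ-∣ c p))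
    where
    distrib : ∀ c x y → c * (x - y) ≡ c * x - c * y
    distrib = solve-∀

  *-cancel-mod : ∀ c {d x y} .{{_ : ℤ.NonZero c}} → c * x ≡ c * y mod c * d → x ≡ y mod d
  *-cancel-mod c {d} {x} {y} (congruent p) =
    congruent (*-cancelˡ-∣ c (subst (c * d ∣_) (distrib c x y) p))
    where
    distrib : ∀ c x y → c * x - c * y ≡ c * (x - y)
    distrib = solve-∀

  %ℕ-mod : ∀ x k .{{_ : ℕ.NonZero k}} → + (x %ℕ k) ≡ x mod + k
  %ℕ-mod x k = subst (λ y → + (x %ℕ k) ≡ y mod + k) (sym (a≡a%ℕn+[a/ℕn]*n x k))
    (mod-sym (+-multiple-mod (+ (x %ℕ k)) (x /ℕ k)))

  residue-injective : ∀ {k a b} .{{_ : NonZero k}} → a ℕ.< k → b ℕ.< k → + a ≡ + b mod + k → a ≡ b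
  residue-injective {k} {a} {b} a<k b<k a≡b =
    [ (λ a≤b → ℕₚ.≤-antisym a≤b (residue-≤ a≤b b<k (mod-sym a≡b)))
    , (λ b≤a → sym (ℕₚ.≤-antisym b≤a (residue-≤ b≤a a<k a≡b)))
    ]′ (ℕₚ.≤-total a b)
    where
    residue-≤ : ∀ {a b} → a ℕ.≤ b → b ℕ.< k → + b ≡ + a mod + k → b ℕ.≤ a
    residue-≤ {a} {b} a≤b b<k (congruent k∣b-a) =
      ℕₚ.m∸n≡0⇒m≤n (trans (sym (ℕ÷.m<n⇒m%n≡m (ℕₚ.≤-<-trans (ℕₚ.m∸n≤m b a) b<k)))
                         (ℕᵈ.n∣m⇒m%n≡0 _ k (∣⇒∣ᵤ k∣b∸a)))
      where
      k∣b∸a : + k ∣ + (b ∸ a)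
      k∣b∸a = subst (+ k ∣_) (trans (ℤₚ.m-n≡m⊖n b a) (ℤₚ.⊖-≥ a≤b)) k∣b-a

  modulus≡0 : ∀ {d} → d ≡ + 0 mod d
  modulus≡0 {d} = congruent (divides (+ 1) (trans (ℤₚ.+-identityʳ d) (sym (ℤₚ.*-identityˡ d))))

open IntegerCongruence

+-suc-cast : ∀ j → + j + + 1 ≡ + suc j
+-suc-cast j = trans (sym (ℤₚ.pos-+ j 1)) (cong +_ (ℕₚ.+-comm j 1))

2∣n*[1+n] : ∀ a → 2 ℕᵈ.∣ a ℕ.* suc a
2∣n*[1+n] zero    = ℕᵈ.divides 0 refl
2∣n*[1+n] (suc a) = subst (2 ℕᵈ.∣_) (step a) (ℕᵈ.∣m∣n⇒∣m+n (2∣n*[1+n] a) (ℕᵈ.m∣m*n (suc a)))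
  where
  step : ∀ a → a ℕ.* suc a ℕ.+ 2 ℕ.* suc a ≡ suc a ℕ.* suc (suc a)
  step = ℕ-Solver.solve-∀

halve : ∀ j → Σ ℕ λ a → j ≡ a ℕ.+ a ⊎ j ≡ suc (a ℕ.+ a)
halve zero    = 0 , inj₁ refl
halve (suc j) with halve j
... | a , inj₁ j≡a+a   = a , inj₂ (cong suc j≡a+a)
... | a , inj₂ j≡1+a+a = suc a , inj₁ (cong suc (trans j≡1+a+a (sym (ℕₚ.+-suc a a))))

module _ {k : ℕ} .{{_ : NonZero k}} where

  open import Data.Integer.Base using (_*_)

  %-mod : ∀ x → + (x % k) ≡ + x mod + k
  %-mod x = %ℕ-mod (+ x) k

  cpow-mod : ∀ ℓ (j : Fin k) → + toℕ (cpow ℓ j) ≡ + toℕ j + + ℓ mod + k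
  cpow-mod ℓ j = subst₂ (λ a b → + a ≡ b mod + k) (sym (Finₚ.toℕ-fromℕ< _)) (ℤₚ.pos-+ (toℕ j) ℓ)
    (%-mod (toℕ j ℕ.+ ℓ))

  refl₁-mod : ∀ (j : Fin k) → + toℕ (refl₁ j) ≡ - + toℕ j mod + k
  refl₁-mod j = begin
    + toℕ (refl₁ j)        ≡⟨ cong +_ (Finₚ.toℕ-fromℕ< _) ⟩
    + ((k ∸ toℕ j) % k)    ≈⟨ %-mod (k ∸ toℕ j) ⟩
    + (k ∸ toℕ j)          ≡⟨ ∸-cast (ℕₚ.<⇒≤ (Finₚ.toℕ<n j)) ⟩
    - + toℕ j + + 1 * + k  ≈⟨ +-multiple-mod (- + toℕ j) (+ 1) ⟩
    - + toℕ j              ∎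
    where
    open ModReasoning
    ∸-cast : ∀ {a} → a ℕ.≤ k → + (k ∸ a) ≡ - + a + + 1 * + k
    ∸-cast {a} a≤k = trans (sym (trans (ℤₚ.m-n≡m⊖n k a) (ℤₚ.⊖-≥ a≤k))) (swap (+ k) (+ a))
      where
      swap : ∀ x y → x - y ≡ - y + + 1 * x
      swap = solve-∀

  toℕ-cpow-1 : ∀ (i : Fin k) → toℕ (cpow 1 i) ≡ suc (toℕ i) % k
  toℕ-cpow-1 i = trans (Finₚ.toℕ-fromℕ< _) (cong (_% k) (ℕₚ.+-comm (toℕ i) 1))

  cpow-1-cases : ∀ (i : Fin k) → toℕ (cpow 1 i) ≡ suc (toℕ i) ⊎ (toℕ (cpow 1 i) ≡ 0 × suc (toℕ i) ≡ k)
  cpow-1-cases i with ℕₚ.m≤n⇒m<n∨m≡n (Finₚ.toℕ<n i)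
  ... | inj₁ 1+i<k = inj₁ (trans (toℕ-cpow-1 i) (ℕ÷.m<n⇒m%n≡m 1+i<k))
  ... | inj₂ 1+i≡k = inj₂ (trans (toℕ-cpow-1 i) (trans (cong (_% k) 1+i≡k) (ℕ÷.n%n≡0 k)) , 1+i≡k)

  refl₁-zero : ∀ {i : Fin k} → toℕ i ≡ 0 → toℕ (refl₁ i) ≡ 0
  refl₁-zero {i} i≡0 = trans (Finₚ.toℕ-fromℕ< _) (trans (cong (λ x → (k ∸ x) % k) i≡0) (ℕ÷.n%n≡0 k))

  refl₁-suc : ∀ {i : Fin k} {a} → toℕ i ≡ suc a → toℕ (refl₁ i) ≡ k ∸ suc a
  refl₁-suc {i} {a} i≡1+a = trans (Finₚ.toℕ-fromℕ< _) (trans (cong (λ x → (k ∸ x) % k) i≡1+a)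
    (ℕ÷.m<n⇒m%n≡m (ℕₚ.∸-monoʳ-< {o = 0} (ℕ.s≤s ℕ.z≤n) (subst (ℕ._≤ k) i≡1+a (ℕₚ.<⇒≤ (Finₚ.toℕ<n i))))))

pow-∈ : ∀ {a} {A : Set a} {g₁ g₂ f : A → A} → ⟨ g₁ , g₂ ⟩ f → ∀ j → ⟨ g₁ , g₂ ⟩ (pow f j)
pow-∈ f∈G zero    = one
pow-∈ f∈G (suc j) = mul (pow-∈ f∈G j) f∈G

pow-double : ∀ {a} {A : Set a} (f : A → A) k → pow f (k ℕ.+ k) ≗ pow (f ⨾ f) k
pow-double f zero    v = refl
pow-double f (suc k) v =
  cong f (trans (cong (λ i → pow f i v) (ℕₚ.+-suc k k)) (cong f (pow-double f k v)))

hasSize-↔ : ∀ {a i} {A : Set a} {I : Set i} {P : (A → A) → Set a} {N} → Fin N ↔ I →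
  (e : I → A → A) → (∀ x → P (e x)) → (∀ x y → e x ≗ e y → x ≡ y) → (∀ f → P f → ∃ λ x → f ≗ e x) →
  HasSize P N
hasSize-↔ {P = P} ι e e∈P e-injective e-covers = e ∘ to , e∈P ∘ to , injective , covers
  where
  open Inverse ι
  injective : ∀ x y → e (to x) ≗ e (to y) → x ≡ y
  injective x y ex≗ey =
    trans (sym (strictlyInverseʳ x)) (trans (cong from (e-injective _ _ ex≗ey)) (strictlyInverseʳ y))
  covers : ∀ f → P f → ∃ λ x → f ≗ e (to x)
  covers f f∈P = from (proj₁ (e-covers f f∈P)) , λ v →
    trans (proj₂ (e-covers f f∈P) v) (cong (λ x → e x v) (sym (strictlyInverseˡ _)))

module QuadraticMaps (n m h : ℤ) (m∣n : m ∣ n) (2h≡1 : + 2 ℤ.* h ≡ + 1 mod m) where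

  open import Data.Integer.Base using (_*_)

  M : ℤ
  M = n * m

  -- x(x−1)/2 modulo m, with h standing for 1/2
  choose₂ : ℤ → ℤ
  choose₂ x = h * (x * (x - + 1))

  sg : Bool → ℤ
  sg false = + 1
  sg true  = - + 1

  sg-involutive : ∀ b x → sg b * (sg b * x) ≡ x
  sg-involutive false x = trans (ℤₚ.*-identityˡ _) (ℤₚ.*-identityˡ x)
  sg-involutive true  x = trans (sym (ℤₚ.*-assoc (- + 1) (- + 1) x)) (ℤₚ.*-identityˡ x)

  ⌊_⌋ : Bool → ℤ
  ⌊ false ⌋ = + 0
  ⌊ true ⌋  = + 1

  record QMap : Set where
    constructor qmap
    field
      reflecting : Bool
      shift      : ℤ
      slope      : ℤ

  open QMap public

  twist : ℤ → ℤ → ℤ → ℤ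
  twist e t x = t * x + e * choose₂ x

  ⟦_⟧ : QMap → ℤ → ℤ
  ⟦ qmap b c₀ c₁ ⟧ x = sg b * x + c₀ + n * twist ⌊ b ⌋ c₁ x

  infix 4 _≃_
  record _≃_ (c d : QMap) : Set where
    constructor mk≃
    field
      reflecting-≡ : reflecting c ≡ reflecting d
      shift-≡      : shift c ≡ shift d mod M
      slope-≡      : slope c ≡ slope d mod m

  1ᵠ : QMap
  1ᵠ = qmap false (+ 0) (+ 0)

  infixl 7 _∙_
  _∙_ : QMap → QMap → QMap
  qmap b₁ c₀ c₁ ∙ qmap b₂ d₀ d₁ = qmap (b₁ xor b₂)
    (sg b₂ * c₀ + d₀ + n * twist ⌊ b₂ ⌋ d₁ c₀)
    (sg b₂ * c₁ + sg b₁ * d₁ + ⌊ b₂ ⌋ * (⌊ b₁ ⌋ + sg b₁ * c₀))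

  _⁻¹ : QMap → QMap
  qmap b c₀ c₁ ⁻¹ = qmap b (- (sg b * c₀) - n * twist ⌊ b ⌋ d₁ c₀) d₁
    where
    d₁ : ℤ
    d₁ = - c₁ - ⌊ b ⌋ * (sg b + c₀)

  n≡0 : n ≡ + 0 mod m
  n≡0 = congruent (subst (m ∣_) (sym (ℤₚ.+-identityʳ n)) m∣n)

  m∣M : m ∣ M
  m∣M = ∣n⇒∣m*n n ∣-refl

  n*-cong : ∀ {x y} → x ≡ y mod m → n * x ≡ n * y mod M
  n*-cong = *-scale-mod n

  choose₂-cong : ∀ {d x y} → x ≡ y mod d → choose₂ x ≡ choose₂ y mod d
  choose₂-cong p = *-congˡ-mod h (*-cong-mod p (+-congʳ-mod (- + 1) p))

  twist-cong : ∀ e t {x y} → x ≡ y mod m → twist e t x ≡ twist e t y mod m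
  twist-cong e t p = +-cong-mod (*-congˡ-mod t p) (*-congˡ-mod e (choose₂-cong p))

  choose₂-shift : ∀ b x c →
    choose₂ (sg b * x + c) ≡ choose₂ x + choose₂ c + + 2 * h * ((⌊ b ⌋ + sg b * c) * x)
  choose₂-shift false x c = expand h x c
    where
    expand : ∀ h x c → h * ((+ 1 * x + c) * ((+ 1 * x + c) - + 1))
           ≡ h * (x * (x - + 1)) + h * (c * (c - + 1)) + + 2 * h * ((+ 0 + + 1 * c) * x)
    expand = solve-∀
  choose₂-shift true x c = expand h x c
    where
    expand : ∀ h x c → h * ((- + 1 * x + c) * ((- + 1 * x + c) - + 1))
           ≡ h * (x * (x - + 1)) + h * (c * (c - + 1)) + + 2 * h * ((+ 1 + - + 1 * c) * x)
    expand = solve-∀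

  n*-halve : ∀ a w → n * (a + + 2 * h * w) ≡ n * (a + w) mod M
  n*-halve a w = n*-cong (+-congˡ-mod a
    (mod-trans (*-congʳ-mod w 2h≡1) (mod-reflexive (ℤₚ.*-identityˡ w))))

  choose₂-half : ∀ x q → x * (x - + 1) ≡ + 2 * q → choose₂ x ≡ q mod m
  choose₂-half x q pronic = begin
    h * (x * (x - + 1))  ≡⟨ cong (h *_) pronic ⟩
    h * (+ 2 * q)        ≡⟨ reassoc h q ⟩
    + 2 * h * q          ≈⟨ *-congʳ-mod q 2h≡1 ⟩
    + 1 * q              ≡⟨ ℤₚ.*-identityˡ q ⟩
    q                    ∎
    where
    open ModReasoning
    reassoc : ∀ h q → h * (+ 2 * q) ≡ + 2 * h * q
    reassoc = solve-∀

  sg-xor : ∀ b₁ b₂ → sg (b₁ xor b₂) ≡ sg b₂ * sg b₁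
  sg-xor false false = refl
  sg-xor false true  = refl
  sg-xor true  false = refl
  sg-xor true  true  = refl

  ⌊⌋-xor : ∀ b₁ b₂ → ⌊ b₁ xor b₂ ⌋ ≡ sg b₂ * ⌊ b₁ ⌋ + ⌊ b₂ ⌋
  ⌊⌋-xor false false = refl
  ⌊⌋-xor false true  = refl
  ⌊⌋-xor true  false = refl
  ⌊⌋-xor true  true  = refl

  ⟦⟧-cong : ∀ c {x y} → x ≡ y mod M → ⟦ c ⟧ x ≡ ⟦ c ⟧ y mod M
  ⟦⟧-cong (qmap b c₀ c₁) p = +-cong-mod (+-congʳ-mod c₀ (*-congˡ-mod (sg b) p))
    (n*-cong (twist-cong ⌊ b ⌋ c₁ (mod-weaken m∣M p)))

  ⟦⟧-resp-≃ : ∀ {c d} → c ≃ d → ∀ x → ⟦ c ⟧ x ≡ ⟦ d ⟧ x mod M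
  ⟦⟧-resp-≃ {qmap b c₀ c₁} {qmap .b d₀ d₁} (mk≃ refl c₀≡d₀ c₁≡d₁) x =
    +-cong-mod (+-congˡ-mod (sg b * x) c₀≡d₀)
      (n*-cong (+-congʳ-mod (⌊ b ⌋ * choose₂ x) (*-congʳ-mod x c₁≡d₁)))

  ⟦⟧-∙ : ∀ c d x → ⟦ d ⟧ (⟦ c ⟧ x) ≡ ⟦ c ∙ d ⟧ x mod M
  ⟦⟧-∙ (qmap b₁ c₀ c₁) (qmap b₂ d₀ d₁) x = begin
    δ * y + d₀ + n * twist e₂ d₁ y
      ≈⟨ +-congˡ-mod (δ * y + d₀) (n*-cong (twist-cong e₂ d₁ y≡z)) ⟩
    δ * y + d₀ + n * twist e₂ d₁ z
      ≡⟨ cong (λ u → δ * y + d₀ + n * (d₁ * z + e₂ * u)) (choose₂-shift b₁ x c₀) ⟩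
    δ * y + d₀ + n * (d₁ * z + e₂ * (choose₂ x + choose₂ c₀ + + 2 * h * (w * x)))
      ≡⟨ expand δ ε e₁ e₂ x c₀ c₁ d₀ d₁ (choose₂ x) (choose₂ c₀) n h ⟩
    δ * ε * x + s + n * (a + + 2 * h * (e₂ * w * x))
      ≈⟨ +-congˡ-mod (δ * ε * x + s) (n*-halve a (e₂ * w * x)) ⟩
    δ * ε * x + s + n * (a + e₂ * w * x)
      ≡⟨ collect δ ε e₁ e₂ x c₀ c₁ d₁ (choose₂ x) s n ⟩
    δ * ε * x + s + n * twist (δ * e₁ + e₂) (δ * c₁ + ε * d₁ + e₂ * w) x
      ≡⟨ cong₂ (λ σ e → σ * x + s + n * twist e (δ * c₁ + ε * d₁ + e₂ * w) x)
               (sym (sg-xor b₁ b₂)) (sym (⌊⌋-xor b₁ b₂)) ⟩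
    ⟦ qmap b₁ c₀ c₁ ∙ qmap b₂ d₀ d₁ ⟧ x ∎
    where
    open ModReasoning
    ε δ e₁ e₂ z y w s a : ℤ
    ε = sg b₁
    δ = sg b₂
    e₁ = ⌊ b₁ ⌋
    e₂ = ⌊ b₂ ⌋
    z = ε * x + c₀
    y = z + n * twist e₁ c₁ x
    w = e₁ + ε * c₀
    s = δ * c₀ + d₀ + n * twist e₂ d₁ c₀
    a = (δ * c₁ + ε * d₁) * x + (δ * e₁ + e₂) * choose₂ x
    y≡z : y ≡ z mod m
    y≡z = mod-trans (+-congˡ-mod z (*-congʳ-mod (twist e₁ c₁ x) n≡0))
                    (mod-reflexive (ℤₚ.+-identityʳ z))
    expand : ∀ δ ε e₁ e₂ x c₀ c₁ d₀ d₁ Cx Cc n h →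
      δ * (ε * x + c₀ + n * (c₁ * x + e₁ * Cx)) + d₀
        + n * (d₁ * (ε * x + c₀) + e₂ * (Cx + Cc + + 2 * h * ((e₁ + ε * c₀) * x)))
      ≡ δ * ε * x + (δ * c₀ + d₀ + n * (d₁ * c₀ + e₂ * Cc))
        + n * ((δ * c₁ + ε * d₁) * x + (δ * e₁ + e₂) * Cx + + 2 * h * (e₂ * (e₁ + ε * c₀) * x))
    expand = solve-∀
    collect : ∀ δ ε e₁ e₂ x c₀ c₁ d₁ Cx s n →
      δ * ε * x + s + n * ((δ * c₁ + ε * d₁) * x + (δ * e₁ + e₂) * Cx + e₂ * (e₁ + ε * c₀) * x)
      ≡ δ * ε * x + s + n * ((δ * c₁ + ε * d₁ + e₂ * (e₁ + ε * c₀)) * x + (δ * e₁ + e₂) * Cx)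
    collect = solve-∀

  ⟦1ᵠ⟧ : ∀ x → ⟦ 1ᵠ ⟧ x ≡ x
  ⟦1ᵠ⟧ x = identity x n (choose₂ x)
    where
    identity : ∀ x n Cx → + 1 * x + + 0 + n * (+ 0 * x + + 0 * Cx) ≡ x
    identity = solve-∀

  ∙-inverseʳ : ∀ c → c ∙ c ⁻¹ ≃ 1ᵠ
  ∙-inverseʳ (qmap b c₀ c₁) =
    mk≃ (xor-same b) (mod-reflexive (cancel (sg b * c₀) (n * twist ⌊ b ⌋ d₁ c₀)))
                     (mod-reflexive (slope-cancels b))
    where
    d₁ : ℤ
    d₁ = - c₁ - ⌊ b ⌋ * (sg b + c₀)
    cancel : ∀ a t → a + (- a - t) + t ≡ + 0
    cancel = solve-∀
    slope-cancels : ∀ b →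
      sg b * c₁ + sg b * (- c₁ - ⌊ b ⌋ * (sg b + c₀)) + ⌊ b ⌋ * (⌊ b ⌋ + sg b * c₀) ≡ + 0
    slope-cancels false = identity c₀ c₁
      where
      identity : ∀ c₀ c₁ → + 1 * c₁ + + 1 * (- c₁ - + 0 * (+ 1 + c₀)) + + 0 * (+ 0 + + 1 * c₀) ≡ + 0
      identity = solve-∀
    slope-cancels true = identity c₀ c₁
      where
      identity : ∀ c₀ c₁ →
        - + 1 * c₁ + - + 1 * (- c₁ - + 1 * (- + 1 + c₀)) + + 1 * (+ 1 + - + 1 * c₀) ≡ + 0
      identity = solve-∀

  ⟦⟧-at-0 : ∀ c → ⟦ c ⟧ (+ 0) ≡ shift c
  ⟦⟧-at-0 (qmap b c₀ c₁) = identity (sg b) c₀ c₁ ⌊ b ⌋ n h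
    where
    identity : ∀ σ c₀ c₁ e n h → σ * + 0 + c₀ + n * (c₁ * + 0 + e * (h * (+ 0 * (+ 0 - + 1)))) ≡ c₀
    identity = solve-∀

  ⟦⟧-at-1 : ∀ c → ⟦ c ⟧ (+ 1) ≡ shift c + (sg (reflecting c) + n * slope c)
  ⟦⟧-at-1 (qmap b c₀ c₁) = identity (sg b) c₀ c₁ ⌊ b ⌋ n h
    where
    identity : ∀ σ c₀ c₁ e n h →
      σ * + 1 + c₀ + n * (c₁ * + 1 + e * (h * (+ 1 * (+ 1 - + 1)))) ≡ c₀ + (σ + n * c₁)
    identity = solve-∀

  sg-injective : ¬ (n ∣ + 2) → ∀ {b b′} → sg b ≡ sg b′ mod n → b ≡ b′
  sg-injective n∤2 {false} {false} _ = refl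
  sg-injective n∤2 {false} {true} (congruent n∣2) = contradiction n∣2 n∤2
  sg-injective n∤2 {true} {false} (congruent n∣-2) = contradiction (∣m⇒∣-m n∣-2) n∤2
  sg-injective n∤2 {true} {true} _ = refl

  linear-injective : .{{_ : ℤ.NonZero n}} → ¬ (n ∣ + 2) → ∀ {b b′ t t′} →
    sg b + n * t ≡ sg b′ + n * t′ mod M → b ≡ b′ × (t ≡ t′ mod m)
  linear-injective n∤2 {b} {b′} {t} {t′} p = b≡b′ , slope-≡ b≡b′ p
    where
    drop-multiple : ∀ σ u → σ + n * u ≡ σ mod n
    drop-multiple σ u = subst (λ v → σ + v ≡ σ mod n) (ℤₚ.*-comm u n) (+-multiple-mod σ u)
    b≡b′ : b ≡ b′
    b≡b′ = sg-injective n∤2 (mod-trans (mod-sym (drop-multiple (sg b) t))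
             (mod-trans (mod-weaken (∣m⇒∣m*n m ∣-refl) p) (drop-multiple (sg b′) t′)))
    slope-≡ : ∀ {b′} → b ≡ b′ → sg b + n * t ≡ sg b′ + n * t′ mod M → t ≡ t′ mod m
    slope-≡ {b′} refl q = *-cancel-mod n (+-cancelˡ-mod q (mod-refl {x = sg b′}))

  ≃-from-values : .{{_ : ℤ.NonZero n}} → ¬ (n ∣ + 2) → ∀ c d →
    ⟦ c ⟧ (+ 0) ≡ ⟦ d ⟧ (+ 0) mod M → ⟦ c ⟧ (+ 1) ≡ ⟦ d ⟧ (+ 1) mod M → c ≃ d
  ≃-from-values n∤2 c d at0 at1 = mk≃ (proj₁ parts) c₀≡d₀ (proj₂ parts)
    where
    c₀≡d₀ : shift c ≡ shift d mod M
    c₀≡d₀ = subst₂ (λ x y → x ≡ y mod M) (⟦⟧-at-0 c) (⟦⟧-at-0 d) at0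
    linear : sg (reflecting c) + n * slope c ≡ sg (reflecting d) + n * slope d mod M
    linear = +-cancelˡ-mod (subst₂ (λ x y → x ≡ y mod M) (⟦⟧-at-1 c) (⟦⟧-at-1 d) at1) c₀≡d₀
    parts : reflecting c ≡ reflecting d × (slope c ≡ slope d mod m)
    parts = linear-injective n∤2 linear

module GraphAction (m s : ℕ) .{{_ : NonZero m}} .{{_ : NonZero s}} (3≤m : 3 ℕ.≤ m)
                   (h : ℤ) (2h≡1 : + 2 ℤ.* h ≡ + 1 mod + m) where

  open import Data.Integer.Base using (_*_)

  n : ℕ
  n = s ℕ.* m

  instance
    n≢0 : NonZero n
    n≢0 = ℕₚ.m*n≢0 s m

  m∣n : + m ∣ + n
  m∣n = divides (+ s) (ℤₚ.pos-* s m)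

  open QuadraticMaps (+ n) (+ m) h m∣n 2h≡1

  3≤n : 3 ℕ.≤ n
  3≤n = ℕₚ.≤-trans 3≤m (ℕₚ.m≤n*m m s)

  -- Spiral coordinates

  carry : ℕ → ℤ
  carry zero    = + 0
  carry (suc _) = + 1

  carry-pos : ∀ {x} → 0 ℕ.< x → carry x ≡ + 1
  carry-pos {suc _} _ = refl

  spiral : ℕ → ℤ → ℤ
  spiral x y = + x + + n * (y - carry x)

  enc : Vtx m s → ℤ
  enc (i , j) = spiral (toℕ i) (+ toℕ j)

  spiral-cong : ∀ x {y y′} → y ≡ y′ mod + m → spiral x y ≡ spiral x y′ mod M
  spiral-cong x p = +-congˡ-mod (+ x) (n*-cong (+-congʳ-mod (- carry x) p))

  spiral≡layer-mod-m : ∀ x y → spiral x y ≡ + x mod + m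
  spiral≡layer-mod-m x y = mod-trans (+-congˡ-mod (+ x) (*-congʳ-mod (y - carry x) n≡0))
                               (mod-reflexive (ℤₚ.+-identityʳ (+ x)))

  spiral≡layer-mod-n : ∀ x y → spiral x y ≡ + x mod + n
  spiral≡layer-mod-n x y = subst (λ t → + x + t ≡ + x mod + n) (ℤₚ.*-comm (y - carry x) (+ n))
    (+-multiple-mod (+ x) (y - carry x))

  spiral-layer-injective : ∀ {x x′ y y′} → x ℕ.< n → x′ ℕ.< n →
    spiral x y ≡ spiral x′ y′ mod M → x ≡ x′
  spiral-layer-injective {x} {x′} {y} {y′} x<n x′<n p = residue-injective x<n x′<n (begin
    + x          ≈⟨ spiral≡layer-mod-n x y ⟨
    spiral x y   ≈⟨ mod-weaken (∣m⇒∣m*n (+ m) ∣-refl) p ⟩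
    spiral x′ y′ ≈⟨ spiral≡layer-mod-n x′ y′ ⟩
    + x′         ∎)
    where open ModReasoning

  spiral-fibre-injective : ∀ x {y y′} → spiral x y ≡ spiral x y′ mod M → y ≡ y′ mod + m
  spiral-fibre-injective x {y} {y′} p = begin
    y                      ≡⟨ uncarry y (carry x) ⟨
    y - carry x + carry x  ≈⟨ +-congʳ-mod (carry x) offsets ⟩
    y′ - carry x + carry x ≡⟨ uncarry y′ (carry x) ⟩
    y′                     ∎
    where
    open ModReasoning
    offsets : y - carry x ≡ y′ - carry x mod + m
    offsets = *-cancel-mod (+ n) (+-cancelˡ-mod p (mod-refl {x = + x}))
    uncarry : ∀ y c → y - c + c ≡ y
    uncarry = solve-∀

  enc-injective : ∀ v w → enc v ≡ enc w mod M → v ≡ w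
  enc-injective (i , j) (i′ , j′) p = cong₂ _,_ i≡i′ j≡j′
    where
    layers : toℕ i ≡ toℕ i′
    layers = spiral-layer-injective {y = + toℕ j} {+ toℕ j′} (Finₚ.toℕ<n i) (Finₚ.toℕ<n i′) p
    i≡i′ : i ≡ i′
    i≡i′ = Finₚ.toℕ-injective layers
    same-layer : spiral (toℕ i) (+ toℕ j) ≡ spiral (toℕ i) (+ toℕ j′) mod M
    same-layer = subst (λ x → spiral (toℕ i) (+ toℕ j) ≡ spiral x (+ toℕ j′) mod M) (sym layers) p
    j≡j′ : j ≡ j′
    j≡j′ = Finₚ.toℕ-injective (residue-injective (Finₚ.toℕ<n j) (Finₚ.toℕ<n j′)
             (spiral-fibre-injective (toℕ i) same-layer))

  -- The generators in spiral coordinates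

  σ₁-zero : ∀ {i j} → toℕ i ≡ 0 → σ₁ m s (i , j) ≡ (cpow 1 i , cpow 1 j)
  σ₁-zero i≡0 rewrite i≡0 = refl

  σ₁-suc : ∀ {i j a} → toℕ i ≡ suc a → σ₁ m s (i , j) ≡ (cpow 1 i , j)
  σ₁-suc i≡1+a rewrite i≡1+a = refl

  σ₂-zero : ∀ {i j} → toℕ i ≡ 0 → σ₂ m s (i , j) ≡ (refl₁ i , refl₁ j)
  σ₂-zero i≡0 rewrite i≡0 = refl

  σ₂-suc : ∀ {i j a} → toℕ i ≡ suc a → σ₂ m s (i , j) ≡ (refl₁ i , cpow (ell (suc a)) (refl₁ j))
  σ₂-suc i≡1+a rewrite i≡1+a = refl

  spiral-suc : ∀ a y → spiral (suc (suc a)) y ≡ spiral (suc a) y + + 1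
  spiral-suc a y = trans (cong (λ x → x + + n * (y - + 1)) (sym (+-suc-cast (suc a))))
                         (regroup (+ suc a) (+ n * (y - + 1)))
    where
    regroup : ∀ x t → x + + 1 + t ≡ x + t + + 1
    regroup = solve-∀

  spiral-wrap : ∀ a y → suc (suc a) ≡ n → spiral 0 y ≡ spiral (suc a) y + + 1
  spiral-wrap a y 2+a≡n = subst (λ N → + 0 + N * (y - + 0) ≡ + suc a + N * (y - + 1) + + 1)
    (trans (+-suc-cast (suc a)) (cong +_ 2+a≡n))
    (wrap (+ suc a) y)
    where
    wrap : ∀ x y → + 0 + (x + + 1) * (y - + 0) ≡ x + (x + + 1) * (y - + 1) + + 1
    wrap = solve-∀

  enc-σ₁ : ∀ v → enc (σ₁ m s v) ≡ enc v + + 1 mod M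
  enc-σ₁ (i , j) = by-layer (toℕ i) refl (cpow-1-cases i)
    where
    open ModReasoning
    by-layer : ∀ x → toℕ i ≡ x → toℕ (cpow 1 i) ≡ suc (toℕ i) ⊎ (toℕ (cpow 1 i) ≡ 0 × suc (toℕ i) ≡ n) →
               enc (σ₁ m s (i , j)) ≡ enc (i , j) + + 1 mod M
    by-layer zero i≡0 (inj₁ next) = begin
      enc (σ₁ m s (i , j))              ≡⟨ cong enc (σ₁-zero i≡0) ⟩
      spiral (toℕ (cpow 1 i)) (+ toℕ (cpow 1 j))
        ≡⟨ cong (λ x → spiral x (+ toℕ (cpow 1 j))) (trans next (cong suc i≡0)) ⟩
      spiral 1 (+ toℕ (cpow 1 j))       ≈⟨ spiral-cong 1 (cpow-mod 1 j) ⟩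
      spiral 1 (+ toℕ j + + 1)          ≡⟨ step (+ n) (+ toℕ j) ⟩
      spiral 0 (+ toℕ j) + + 1          ≡⟨ cong (λ x → spiral x (+ toℕ j) + + 1) i≡0 ⟨
      enc (i , j) + + 1                 ∎
      where
      step : ∀ N y → + 1 + N * (y + + 1 - + 1) ≡ + 0 + N * (y - + 0) + + 1
      step = solve-∀
    by-layer zero i≡0 (inj₂ (_ , 1+i≡n)) =
      contradiction (subst (3 ℕ.≤_) (trans (sym 1+i≡n) (cong suc i≡0)) 3≤n) λ { (ℕ.s≤s ()) }
    by-layer (suc a) i≡1+a (inj₁ next) = begin
      enc (σ₁ m s (i , j))              ≡⟨ cong enc (σ₁-suc i≡1+a) ⟩
      spiral (toℕ (cpow 1 i)) (+ toℕ j)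
        ≡⟨ cong (λ x → spiral x (+ toℕ j)) (trans next (cong suc i≡1+a)) ⟩
      spiral (suc (suc a)) (+ toℕ j)    ≡⟨ spiral-suc a (+ toℕ j) ⟩
      spiral (suc a) (+ toℕ j) + + 1    ≡⟨ cong (λ x → spiral x (+ toℕ j) + + 1) i≡1+a ⟨
      enc (i , j) + + 1                 ∎
    by-layer (suc a) i≡1+a (inj₂ (wrapped , 1+i≡n)) = begin
      enc (σ₁ m s (i , j))              ≡⟨ cong enc (σ₁-suc i≡1+a) ⟩
      spiral (toℕ (cpow 1 i)) (+ toℕ j) ≡⟨ cong (λ x → spiral x (+ toℕ j)) wrapped ⟩
      spiral 0 (+ toℕ j)                ≡⟨ spiral-wrap a (+ toℕ j) (trans (cong suc (sym i≡1+a)) 1+i≡n) ⟩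
      spiral (suc a) (+ toℕ j) + + 1    ≡⟨ cong (λ x → spiral x (+ toℕ j) + + 1) i≡1+a ⟨
      enc (i , j) + + 1                 ∎

  σ₁ᵠ σ₂ᵠ : QMap
  σ₁ᵠ = qmap false (+ 1) (+ 0)
  σ₂ᵠ = qmap true (+ 0) (+ 0)

  ⟦σ₁ᵠ⟧ : ∀ x → ⟦ σ₁ᵠ ⟧ x ≡ x + + 1
  ⟦σ₁ᵠ⟧ x = identity x (+ n) (choose₂ x)
    where
    identity : ∀ x N Cx → + 1 * x + + 1 + N * (+ 0 * x + + 0 * Cx) ≡ x + + 1
    identity = solve-∀

  ⟦σ₂ᵠ⟧-spiral : ∀ x y → ⟦ σ₂ᵠ ⟧ (spiral x y) ≡ - spiral x y + + n * choose₂ (+ x) mod M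
  ⟦σ₂ᵠ⟧-spiral x y = mod-trans
    (+-congˡ-mod (- + 1 * spiral x y + + 0) (n*-cong (twist-cong (+ 1) (+ 0) (spiral≡layer-mod-m x y))))
    (mod-reflexive (identity (spiral x y) (+ n) (+ x) (choose₂ (+ x))))
    where
    identity : ∀ X N x Cx → - + 1 * X + + 0 + N * (+ 0 * x + + 1 * Cx) ≡ - X + N * Cx
    identity = solve-∀

  ell-mod : ∀ a → + ell (suc a) ≡ + 1 + choose₂ (+ suc a) mod + m
  ell-mod a = mod-trans (mod-reflexive (ℤₚ.pos-+ 1 q))
    (+-congˡ-mod (+ 1) (mod-sym (choose₂-half (+ suc a) (+ q) pronic)))
    where
    q : ℕ
    q = (a ℕ.* suc a) ℕ./ 2
    pronic : + suc a * (+ suc a - + 1) ≡ + 2 * + q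
    pronic = begin
      + suc a * (+ suc a - + 1)        ≡⟨ cong (λ A → A * (A - + 1)) (sym (+-suc-cast a)) ⟩
      (+ a + + 1) * (+ a + + 1 - + 1)  ≡⟨ expand (+ a) ⟩
      + a * (+ a + + 1)                ≡⟨ cong (λ A → + a * A) (ℤₚ.pos-+ a 1) ⟨
      + a * + (a ℕ.+ 1)                ≡⟨ ℤₚ.pos-* a (a ℕ.+ 1) ⟨
      + (a ℕ.* (a ℕ.+ 1))              ≡⟨ cong (λ b → + (a ℕ.* b)) (ℕₚ.+-comm a 1) ⟩
      + (a ℕ.* suc a)                  ≡⟨ cong +_ (ℕ÷.m*[n/m]≡n (2∣n*[1+n] a)) ⟨
      + (2 ℕ.* q)                      ≡⟨ ℤₚ.pos-* 2 q ⟩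
      + 2 * + q                        ∎
      where
      open ≡-Reasoning
      expand : ∀ A → (A + + 1) * (A + + 1 - + 1) ≡ A * (A + + 1)
      expand = solve-∀

  spiral-reflected : ∀ a y C → suc a ℕ.< n →
    spiral (n ∸ suc a) (- y + (+ 1 + C)) ≡ - spiral (suc a) y + + n * C
  spiral-reflected a y C 1+a<n = trans
    (cong₂ (λ x c → x + + n * (- y + (+ 1 + C) - c))
           (sym (trans (ℤₚ.m-n≡m⊖n n (suc a)) (ℤₚ.⊖-≥ (ℕₚ.<⇒≤ 1+a<n))))
           (carry-pos (ℕₚ.m<n⇒0<n∸m 1+a<n)))
    (identity (+ n) (+ suc a) y C)
    where
    identity : ∀ N A y C → N - A + N * (- y + (+ 1 + C) - + 1) ≡ - (A + N * (y - + 1)) + N * C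
    identity = solve-∀

  enc-σ₂ : ∀ v → enc (σ₂ m s v) ≡ ⟦ σ₂ᵠ ⟧ (enc v) mod M
  enc-σ₂ (i , j) = by-layer (toℕ i) refl
    where
    open ModReasoning
    by-layer : ∀ x → toℕ i ≡ x → enc (σ₂ m s (i , j)) ≡ ⟦ σ₂ᵠ ⟧ (enc (i , j)) mod M
    by-layer zero i≡0 = begin
      enc (σ₂ m s (i , j))                         ≡⟨ cong enc (σ₂-zero i≡0) ⟩
      spiral (toℕ (refl₁ i)) (+ toℕ (refl₁ j))
        ≡⟨ cong (λ x → spiral x (+ toℕ (refl₁ j))) (refl₁-zero i≡0) ⟩
      spiral 0 (+ toℕ (refl₁ j))                   ≈⟨ spiral-cong 0 (refl₁-mod j) ⟩
      spiral 0 (- + toℕ j)                         ≡⟨ negate (+ n) (+ toℕ j) h ⟩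
      - spiral 0 (+ toℕ j) + + n * choose₂ (+ 0)   ≈⟨ ⟦σ₂ᵠ⟧-spiral 0 (+ toℕ j) ⟨
      ⟦ σ₂ᵠ ⟧ (spiral 0 (+ toℕ j))                 ≡⟨ cong (λ x → ⟦ σ₂ᵠ ⟧ (spiral x (+ toℕ j))) i≡0 ⟨
      ⟦ σ₂ᵠ ⟧ (enc (i , j))                        ∎
      where
      negate : ∀ N y h → + 0 + N * (- y - + 0) ≡ - (+ 0 + N * (y - + 0)) + N * (h * (+ 0 * (+ 0 - + 1)))
      negate = solve-∀
    by-layer (suc a) i≡1+a = begin
      enc (σ₂ m s (i , j))                         ≡⟨ cong enc (σ₂-suc i≡1+a) ⟩
      spiral (toℕ (refl₁ i)) (+ toℕ (cpow ℓ (refl₁ j)))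
        ≡⟨ cong (λ x → spiral x (+ toℕ (cpow ℓ (refl₁ j)))) (refl₁-suc i≡1+a) ⟩
      spiral (n ∸ suc a) (+ toℕ (cpow ℓ (refl₁ j)))        ≈⟨ spiral-cong (n ∸ suc a) fibre ⟩
      spiral (n ∸ suc a) (- + toℕ j + (+ 1 + choose₂ (+ suc a)))
        ≡⟨ spiral-reflected a (+ toℕ j) (choose₂ (+ suc a)) (subst (ℕ._< n) i≡1+a (Finₚ.toℕ<n i)) ⟩
      - spiral (suc a) (+ toℕ j) + + n * choose₂ (+ suc a) ≈⟨ ⟦σ₂ᵠ⟧-spiral (suc a) (+ toℕ j) ⟨
      ⟦ σ₂ᵠ ⟧ (spiral (suc a) (+ toℕ j))
        ≡⟨ cong (λ x → ⟦ σ₂ᵠ ⟧ (spiral x (+ toℕ j))) i≡1+a ⟨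
      ⟦ σ₂ᵠ ⟧ (enc (i , j))                                ∎
      where
      ℓ : ℕ
      ℓ = ell (suc a)
      fibre : + toℕ (cpow ℓ (refl₁ j)) ≡ - + toℕ j + (+ 1 + choose₂ (+ suc a)) mod + m
      fibre = mod-trans (cpow-mod ℓ (refl₁ j)) (+-cong-mod (refl₁-mod j) (ell-mod a))

  -- Realisation by quadratic maps

  infix 4 _realises_
  record _realises_ (c : QMap) (f : Vtx m s → Vtx m s) : Set where
    constructor realisation
    field commutes : ∀ v → enc (f v) ≡ ⟦ c ⟧ (enc v) mod M

  open _realises_

  realises-idf : 1ᵠ realises idf
  realises-idf = realisation λ v → mod-reflexive (sym (⟦1ᵠ⟧ (enc v)))

  realises-σ₁ : σ₁ᵠ realises σ₁ m s
  realises-σ₁ = realisation λ v → mod-trans (enc-σ₁ v) (mod-reflexive (sym (⟦σ₁ᵠ⟧ (enc v))))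

  realises-σ₂ : σ₂ᵠ realises σ₂ m s
  realises-σ₂ = realisation enc-σ₂

  realises-⨾ : ∀ {c d f g} → c realises f → d realises g → c ∙ d realises f ⨾ g
  realises-⨾ {c} {d} {f} c⊨f d⊨g = realisation λ v →
    mod-trans (commutes d⊨g (f v)) (mod-trans (⟦⟧-cong d (commutes c⊨f v)) (⟦⟧-∙ c d (enc v)))

  realises-≗ : ∀ {c f g} → f ≗ g → c realises f → c realises g
  realises-≗ {c} f≗g c⊨f = realisation λ v →
    subst (λ w → enc w ≡ ⟦ c ⟧ (enc v) mod M) (f≗g v) (commutes c⊨f v)

  realises-≃ : ∀ {c d f} → c ≃ d → c realises f → d realises f
  realises-≃ c≃d c⊨f = realisation λ v → mod-trans (commutes c⊨f v) (⟦⟧-resp-≃ c≃d (enc v))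

  realises-inverse : ∀ {c f g} → c realises f → (g ⨾ f) ≗ idf → c ⁻¹ realises g
  realises-inverse {c} {f} {g} c⊨f gf≗id = realisation λ v → mod-sym (begin
    ⟦ c ⁻¹ ⟧ (enc v)                ≡⟨ cong (λ w → ⟦ c ⁻¹ ⟧ (enc w)) (gf≗id v) ⟨
    ⟦ c ⁻¹ ⟧ (enc (f (g v)))        ≈⟨ ⟦⟧-cong (c ⁻¹) (commutes c⊨f (g v)) ⟩
    ⟦ c ⁻¹ ⟧ (⟦ c ⟧ (enc (g v)))    ≈⟨ ⟦⟧-∙ c (c ⁻¹) (enc (g v)) ⟩
    ⟦ c ∙ c ⁻¹ ⟧ (enc (g v))        ≈⟨ ⟦⟧-resp-≃ (∙-inverseʳ c) (enc (g v)) ⟩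
    ⟦ 1ᵠ ⟧ (enc (g v))              ≡⟨ ⟦1ᵠ⟧ (enc (g v)) ⟩
    enc (g v)                       ∎)
    where open ModReasoning

  realised : ∀ {f} → ⟨ σ₁ m s , σ₂ m s ⟩ f → Σ QMap (_realises f)
  realised gen₁            = σ₁ᵠ , realises-σ₁
  realised gen₂            = σ₂ᵠ , realises-σ₂
  realised one             = 1ᵠ , realises-idf
  realised (mul p q)       =
    let (c , c⊨f) = realised p ; (d , d⊨g) = realised q in c ∙ d , realises-⨾ c⊨f d⊨g
  realised (inv p _ gf≗id) = let (c , c⊨f) = realised p in c ⁻¹ , realises-inverse c⊨f gf≗id
  realised (ext p f≗g)     = let (c , c⊨f) = realised p in c , realises-≗ f≗g c⊨f

  v₀ : Vtx m s
  v₀ = fromℕ< (ℕₚ.≤-trans (ℕ.s≤s ℕ.z≤n) 3≤n) , fromℕ< (ℕₚ.≤-trans (ℕ.s≤s ℕ.z≤n) 3≤m)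

  enc-v₀ : enc v₀ ≡ + 0 mod M
  enc-v₀ = mod-reflexive (trans (cong₂ (λ x y → spiral x (+ y)) (Finₚ.toℕ-fromℕ< _) (Finₚ.toℕ-fromℕ< _))
                                (origin (+ n)))
    where
    origin : ∀ N → + 0 + N * (+ 0 - + 0) ≡ + 0
    origin = solve-∀

  enc-σ₁v₀ : enc (σ₁ m s v₀) ≡ + 1 mod M
  enc-σ₁v₀ = mod-trans (enc-σ₁ v₀) (+-congʳ-mod (+ 1) enc-v₀)

  n∤2 : ¬ (+ n ∣ + 2)
  n∤2 n∣2 = ℕₚ.<⇒≱ 3≤n (ℕᵈ.∣⇒≤ (∣⇒∣ᵤ n∣2))

  ≗⇒≃ : ∀ {c d f g} → c realises f → d realises g → f ≗ g → c ≃ d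
  ≗⇒≃ {c} {d} {f} {g} c⊨f d⊨g f≗g =
    ≃-from-values n∤2 c d (agree v₀ enc-v₀) (agree (σ₁ m s v₀) enc-σ₁v₀)
    where
    open ModReasoning
    agree : ∀ v {x} → enc v ≡ x mod M → ⟦ c ⟧ x ≡ ⟦ d ⟧ x mod M
    agree v {x} v↦x = begin
      ⟦ c ⟧ x          ≈⟨ ⟦⟧-cong c v↦x ⟨
      ⟦ c ⟧ (enc v)    ≈⟨ commutes c⊨f v ⟨
      enc (f v)        ≡⟨ cong enc (f≗g v) ⟩
      enc (g v)        ≈⟨ commutes d⊨g v ⟩
      ⟦ d ⟧ (enc v)    ≈⟨ ⟦⟧-cong d v↦x ⟩
      ⟦ d ⟧ x          ∎

  ≃⇒≗ : ∀ {c d f g} → c realises f → d realises g → c ≃ d → f ≗ g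
  ≃⇒≗ {c} {d} {f} {g} c⊨f d⊨g c≃d v =
    enc-injective (f v) (g v)
      (mod-trans (commutes c⊨f v) (mod-trans (⟦⟧-resp-≃ c≃d (enc v)) (mod-sym (commutes d⊨g v))))

  -- Orders

  realises-pow : ∀ {c f} (P : ℕ → QMap) → c realises f → 1ᵠ ≃ P 0 → (∀ j → P j ∙ c ≃ P (suc j)) →
    ∀ j → P j realises pow f j
  realises-pow P c⊨f base step zero    = realises-≃ base realises-idf
  realises-pow P c⊨f base step (suc j) =
    realises-≃ (step j) (realises-⨾ (realises-pow P c⊨f base step j) c⊨f)

  realises-σ₁^ : ∀ j → qmap false (+ j) (+ 0) realises pow (σ₁ m s) j
  realises-σ₁^ = realises-pow (λ j → qmap false (+ j) (+ 0)) realises-σ₁ (mk≃ refl mod-refl mod-refl)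
    λ j →
      mk≃ refl (mod-reflexive (trans (shift-step (+ j) (+ n) (choose₂ (+ j))) (+-suc-cast j)))
               (mod-reflexive (slope-step (+ j)))
    where
    shift-step : ∀ x N C → + 1 * x + + 1 + N * (+ 0 * x + + 0 * C) ≡ x + + 1
    shift-step = solve-∀
    slope-step : ∀ x → + 1 * + 0 + + 1 * + 0 + + 0 * (+ 0 + + 1 * x) ≡ + 0
    slope-step = solve-∀

  δ : Vtx m s → Vtx m s
  δ = σ₂ m s ⨾ σ₂ m s

  realises-δ : qmap false (+ 0) (+ 1) realises δ
  realises-δ = realises-≃ (mk≃ refl (mod-reflexive (vanish (+ n) h)) mod-refl)
                          (realises-⨾ realises-σ₂ realises-σ₂)
    where
    vanish : ∀ N h → - + 1 * + 0 + + 0 + N * (+ 0 * + 0 + + 1 * (h * (+ 0 * (+ 0 - + 1)))) ≡ + 0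
    vanish = solve-∀

  realises-δ^ : ∀ a → qmap false (+ 0) (+ a) realises pow δ a
  realises-δ^ = realises-pow (λ a → qmap false (+ 0) (+ a)) realises-δ (mk≃ refl mod-refl mod-refl)
    λ a → mk≃ refl (mod-reflexive (shift-step (+ n) h))
                   (mod-reflexive (trans (slope-step (+ a)) (+-suc-cast a)))
    where
    shift-step : ∀ N h → + 1 * + 0 + + 0 + N * (+ 1 * + 0 + + 0 * (h * (+ 0 * (+ 0 - + 1)))) ≡ + 0
    shift-step = solve-∀
    slope-step : ∀ x → + 1 * x + + 1 * + 1 + + 0 * (+ 0 + + 1 * + 0) ≡ x + + 1
    slope-step = solve-∀

  realises-σ₂^even : ∀ a → qmap false (+ 0) (+ a) realises pow (σ₂ m s) (a ℕ.+ a)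
  realises-σ₂^even a = realises-≗ (λ v → sym (pow-double (σ₂ m s) a v)) (realises-δ^ a)

  Mℕ : ℕ
  Mℕ = m ℕ.* n

  instance
    Mℕ≢0 : NonZero Mℕ
    Mℕ≢0 = ℕₚ.m*n≢0 m n

  Mℕ-cast : + Mℕ ≡ M
  Mℕ-cast = trans (ℤₚ.pos-* m n) (ℤₚ.*-comm (+ m) (+ n))

  mod-Mℕ⇒M : ∀ {x y} → x ≡ y mod + Mℕ → x ≡ y mod M
  mod-Mℕ⇒M {x} {y} = subst (λ d → x ≡ y mod d) Mℕ-cast

  mod-M⇒Mℕ : ∀ {x y} → x ≡ y mod M → x ≡ y mod + Mℕ
  mod-M⇒Mℕ {x} {y} = subst (λ d → x ≡ y mod d) (sym Mℕ-cast)

  order-σ₁ : HasOrder (σ₁ m s) Mℕ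
  order-σ₁ = ℕ.>-nonZero⁻¹ Mℕ , ≃⇒≗ (realises-σ₁^ Mℕ) realises-idf Mℕ≃1 , minimal
    where
    Mℕ≃1 : qmap false (+ Mℕ) (+ 0) ≃ 1ᵠ
    Mℕ≃1 = mk≃ refl (mod-Mℕ⇒M modulus≡0) mod-refl
    minimal : ∀ j → 0 ℕ.< j → j ℕ.< Mℕ → ¬ (pow (σ₁ m s) j ≗ idf)
    minimal j 0<j j<M σ₁ʲ≗id = ℕₚ.<⇒≢ 0<j (sym (residue-injective j<M (ℕ.>-nonZero⁻¹ Mℕ)
      (mod-M⇒Mℕ (_≃_.shift-≡ (≗⇒≃ (realises-σ₁^ j) realises-idf σ₁ʲ≗id)))))

  order-σ₂ : HasOrder (σ₂ m s) (2 ℕ.* m)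
  order-σ₂ = ℕₚ.*-monoʳ-< 2 (ℕ.>-nonZero⁻¹ m)
           , (λ v → trans (cong (λ k → pow (σ₂ m s) k v) 2m≡m+m) (δᵐ≗id v))
           , minimal
    where
    2m≡m+m : 2 ℕ.* m ≡ m ℕ.+ m
    2m≡m+m = cong (m ℕ.+_) (ℕₚ.+-identityʳ m)
    δᵐ≗id : pow (σ₂ m s) (m ℕ.+ m) ≗ idf
    δᵐ≗id = ≃⇒≗ (realises-σ₂^even m) realises-idf (mk≃ refl mod-refl modulus≡0)
    minimal : ∀ j → 0 ℕ.< j → j ℕ.< 2 ℕ.* m → ¬ (pow (σ₂ m s) j ≗ idf)
    minimal j 0<j j<2m σ₂ʲ≗id with halve j
    ... | a , inj₁ refl = ℕₚ.<⇒≢ 0<j (cong (λ a → a ℕ.+ a) (sym a≡0))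
      where
      a<m : a ℕ.< m
      a<m = ℕₚ.≰⇒> λ m≤a → ℕₚ.<⇒≱ (subst (a ℕ.+ a ℕ.<_) 2m≡m+m j<2m) (ℕₚ.+-mono-≤ m≤a m≤a)
      a≡0 : a ≡ 0
      a≡0 = residue-injective a<m (ℕ.>-nonZero⁻¹ m)
              (_≃_.slope-≡ (≗⇒≃ (realises-σ₂^even a) realises-idf σ₂ʲ≗id))
    ... | a , inj₂ refl = contradiction (_≃_.reflecting-≡ (≗⇒≃ odd-power realises-idf σ₂ʲ≗id)) λ ()
      where
      odd-power : qmap false (+ 0) (+ a) ∙ σ₂ᵠ realises pow (σ₂ m s) (suc (a ℕ.+ a))
      odd-power = realises-⨾ (realises-σ₂^even a) realises-σ₂

  order-σ₁σ₂ : HasOrder (σ₁ m s ⨾ σ₂ m s) 2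
  order-σ₁σ₂ = ℕ.s≤s ℕ.z≤n , ≃⇒≗ (realises-⨾ realises-τ realises-τ) realises-idf τ²≃1 , minimal
    where
    τᵠ : QMap
    τᵠ = qmap true (- + 1) (+ 1)
    realises-τ : τᵠ realises σ₁ m s ⨾ σ₂ m s
    realises-τ = realises-≃ (mk≃ refl (mod-reflexive (shift-τ (+ n) h)) mod-refl)
                            (realises-⨾ realises-σ₁ realises-σ₂)
      where
      shift-τ : ∀ N h → - + 1 * + 1 + + 0 + N * (+ 0 * + 1 + + 1 * (h * (+ 1 * (+ 1 - + 1)))) ≡ - + 1
      shift-τ = solve-∀
    τ²≃1 : τᵠ ∙ τᵠ ≃ 1ᵠ
    τ²≃1 = mk≃ refl shift-τ² mod-refl
      where
      open ModReasoning
      regroup : ∀ N h → - + 1 * - + 1 + - + 1 + N * (+ 1 * - + 1 + + 1 * (h * (- + 1 * (- + 1 - + 1))))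
                        ≡ N * (- + 1 + + 2 * h)
      regroup = solve-∀
      vanish : ∀ N → N * (- + 1 + + 1) ≡ + 0
      vanish = solve-∀
      shift-τ² : shift (τᵠ ∙ τᵠ) ≡ + 0 mod M
      shift-τ² = begin
        shift (τᵠ ∙ τᵠ)               ≡⟨ regroup (+ n) h ⟩
        + n * (- + 1 + + 2 * h)       ≈⟨ n*-cong (+-congˡ-mod (- + 1) 2h≡1) ⟩
        + n * (- + 1 + + 1)           ≡⟨ vanish (+ n) ⟩
        + 0                           ∎
    minimal : ∀ j → 0 ℕ.< j → j ℕ.< 2 → ¬ (pow (σ₁ m s ⨾ σ₂ m s) j ≗ idf)
    minimal 1 _ _ τ≗id =
      contradiction (_≃_.reflecting-≡ (≗⇒≃ (realises-≗ (λ _ → refl) realises-τ) realises-idf τ≗id)) λ ()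
    minimal (suc (suc _)) _ (ℕ.s≤s (ℕ.s≤s ())) _

  -- Normal forms and the order of G

  Index : Set
  Index = (Bool × (Fin m × Fin m)) × Fin n

  index↔ : Fin (2 ℕ.* (m ℕ.* m) ℕ.* n) ↔ Index
  index↔ = (((2↔Bool ×-↔ *↔×) ↔-∘ *↔×) ×-↔ ↔-id (Fin n)) ↔-∘ *↔×

  reflection : Bool → Vtx m s → Vtx m s
  reflection false = idf
  reflection true  = σ₂ m s

  normal-form : Index → Vtx m s → Vtx m s
  normal-form ((b , (a , a′)) , i) = reflection b ⨾ (pow δ (toℕ a) ⨾ pow (σ₁ m s) (toℕ (combine a′ i)))

  normal-formᵠ : Index → QMap
  normal-formᵠ ((b , (a , a′)) , i) = qmap b (+ toℕ (combine a′ i)) (sg b * + toℕ a)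

  realises-reflection : ∀ b → qmap b (+ 0) (+ 0) realises reflection b
  realises-reflection false = realises-idf
  realises-reflection true  = realises-σ₂

  realises-normal-form : ∀ x → normal-formᵠ x realises normal-form x
  realises-normal-form ((b , (a , a′)) , i) =
    realises-≃ outer (realises-⨾ (realises-reflection b)
      (realises-≃ inner (realises-⨾ (realises-δ^ (toℕ a)) (realises-σ₁^ r))))
    where
    r : ℕ
    r = toℕ (combine a′ i)
    inner : qmap false (+ 0) (+ toℕ a) ∙ qmap false (+ r) (+ 0) ≃ qmap false (+ r) (+ toℕ a)
    inner = mk≃ refl (mod-reflexive (shift-inner (+ r) (+ n) h))
                     (mod-reflexive (slope-inner (+ toℕ a) (+ r)))
      where
      shift-inner : ∀ x N h → + 1 * + 0 + x + N * (+ 0 * + 0 + + 0 * (h * (+ 0 * (+ 0 - + 1)))) ≡ x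
      shift-inner = solve-∀
      slope-inner : ∀ y x → + 1 * y + + 1 * + 0 + + 0 * (+ 0 + + 1 * + 0) ≡ y
      slope-inner = solve-∀
    outer : qmap b (+ 0) (+ 0) ∙ qmap false (+ r) (+ toℕ a) ≃ normal-formᵠ ((b , (a , a′)) , i)
    outer = mk≃ (xor-identityʳ b) (mod-reflexive (shift-outer (+ r) (+ toℕ a) (+ n) h))
                (mod-reflexive (slope-outer (sg b) ⌊ b ⌋ (+ toℕ a)))
      where
      shift-outer : ∀ x y N h → + 1 * + 0 + x + N * (y * + 0 + + 0 * (h * (+ 0 * (+ 0 - + 1)))) ≡ x
      shift-outer = solve-∀
      slope-outer : ∀ σ e y → + 1 * + 0 + σ * y + + 0 * (e + σ * + 0) ≡ σ * y
      slope-outer = solve-∀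

  normal-form-injective : ∀ x y → normal-form x ≗ normal-form y → x ≡ y
  normal-form-injective x@((b , (a , a′)) , i) y@((b₂ , (a₂ , a₂′)) , i₂) nf≗nf =
    cong₂ _,_ (cong₂ _,_ b≡b₂ (cong₂ _,_ a≡a₂ (proj₁ a′,i≡))) (proj₂ a′,i≡)
    where
    x≃y : normal-formᵠ x ≃ normal-formᵠ y
    x≃y = ≗⇒≃ (realises-normal-form x) (realises-normal-form y) nf≗nf
    b≡b₂ : b ≡ b₂
    b≡b₂ = _≃_.reflecting-≡ x≃y
    a′,i≡ : a′ ≡ a₂′ × i ≡ i₂
    a′,i≡ = Finₚ.combine-injective a′ i a₂′ i₂ (Finₚ.toℕ-injective
              (residue-injective (Finₚ.toℕ<n _) (Finₚ.toℕ<n _) (mod-M⇒Mℕ (_≃_.shift-≡ x≃y))))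
    signed : sg b * + toℕ a ≡ sg b * + toℕ a₂ mod + m
    signed = subst (λ b′ → sg b * + toℕ a ≡ sg b′ * + toℕ a₂ mod + m) (sym b≡b₂) (_≃_.slope-≡ x≃y)
    a≡a₂ : a ≡ a₂
    a≡a₂ = Finₚ.toℕ-injective (residue-injective (Finₚ.toℕ<n a) (Finₚ.toℕ<n a₂)
             (subst₂ (λ u v → u ≡ v mod + m) (sg-involutive b (+ toℕ a)) (sg-involutive b (+ toℕ a₂))
               (*-congˡ-mod (sg b) signed)))

  normal-form-covers : ∀ f → ⟨ σ₁ m s , σ₂ m s ⟩ f → ∃ λ x → f ≗ normal-form x
  normal-form-covers f f∈G = x , ≃⇒≗ c⊨f (realises-normal-form x) c≃x
    where
    c : QMap
    c = proj₁ (realised f∈G)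
    c⊨f : c realises f
    c⊨f = proj₂ (realised f∈G)
    b : Bool
    b = reflecting c
    a : Fin m
    a = fromℕ< (n%ℕd<d (sg b * slope c) m)
    r : Fin Mℕ
    r = fromℕ< (n%ℕd<d (shift c) Mℕ)
    x : Index
    x = ((b , (a , proj₁ (remQuot {m} n r))) , proj₂ (remQuot {m} n r))
    shift≡ : shift c ≡ + toℕ (uncurry combine (remQuot {m} n r)) mod M
    shift≡ = mod-Mℕ⇒M (mod-sym (subst (λ k → + k ≡ shift c mod + Mℕ)
               (sym (trans (cong toℕ (Finₚ.combine-remQuot {m} n r)) (Finₚ.toℕ-fromℕ< _)))
               (%ℕ-mod (shift c) Mℕ)))
    slope≡ : slope c ≡ sg b * + toℕ a mod + m
    slope≡ = mod-sym (begin
      sg b * + toℕ a                 ≡⟨ cong (λ k → sg b * + k) (Finₚ.toℕ-fromℕ< _) ⟩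
      sg b * + ((sg b * slope c) %ℕ m) ≈⟨ *-congˡ-mod (sg b) (%ℕ-mod (sg b * slope c) m) ⟩
      sg b * (sg b * slope c)        ≡⟨ sg-involutive b (slope c) ⟩
      slope c                        ∎)
      where open ModReasoning
    c≃x : c ≃ normal-formᵠ x
    c≃x = mk≃ refl shift≡ slope≡

  normal-form-∈ : ∀ x → ⟨ σ₁ m s , σ₂ m s ⟩ (normal-form x)
  normal-form-∈ ((b , (a , a′)) , i) =
    mul (reflection-∈ b) (mul (pow-∈ (mul gen₂ gen₂) (toℕ a)) (pow-∈ gen₁ (toℕ (combine a′ i))))
    where
    reflection-∈ : ∀ b → ⟨ σ₁ m s , σ₂ m s ⟩ (reflection b)
    reflection-∈ false = one
    reflection-∈ true  = gen₂

  size : HasSize ⟨ σ₁ m s , σ₂ m s ⟩ (2 ℕ.* (m ℕ.* m) ℕ.* n)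
  size = hasSize-↔ index↔ normal-form normal-form-∈ normal-form-injective normal-form-covers

odd-half : ∀ {m k} → m ≡ 2 ℕ.* k ℕ.+ 1 → + 2 ℤ.* + suc k ≡ + 1 mod + m
odd-half {k = k} refl = mod-trans (mod-reflexive (begin
  + 2 ℤ.* + suc k                        ≡⟨ cong (+ 2 ℤ.*_) (ℤₚ.pos-+ 1 k) ⟩
  + 2 ℤ.* (+ 1 + + k)                    ≡⟨ expand (+ k) ⟩
  + 1 + + 1 ℤ.* (+ 2 ℤ.* + k + + 1)      ≡⟨ cong (λ x → + 1 + + 1 ℤ.* (x + + 1)) (ℤₚ.pos-* 2 k) ⟨
  + 1 + + 1 ℤ.* (+ (2 ℕ.* k) + + 1)      ≡⟨ cong (λ x → + 1 + + 1 ℤ.* x) (ℤₚ.pos-+ (2 ℕ.* k) 1) ⟨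
  + 1 + + 1 ℤ.* + (2 ℕ.* k ℕ.+ 1)        ∎)) (+-multiple-mod (+ 1) (+ 1))
  where
  open ≡-Reasoning
  expand : ∀ k → + 2 ℤ.* (+ 1 + k) ≡ + 1 + + 1 ℤ.* (+ 2 ℤ.* k + + 1)
  expand = solve-∀

open import Data.Nat.Base using (_*_; _≤_)

lemma4p1 : (m s : ℕ) .{{_ : NonZero m}} .{{_ : NonZero s}}
    → 3 ≤ m → Odd m
    → HasOrder (σ₁ m s) (m * (s * m))
    × HasOrder (σ₂ m s) (2 * m)
    × HasOrder (σ₁ m s ⨾ σ₂ m s) 2
    × HasSize ⟨ σ₁ m s , σ₂ m s ⟩ (2 * (m * m) * (s * m))
lemma4p1 m s 3≤m (k , m≡2k+1) = order-σ₁ , order-σ₂ , order-σ₁σ₂ , size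
  where open GraphAction m s 3≤m (+ suc k) (odd-half m≡2k+1)
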